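{- Let $n \geq 2$ and let $x_1, x_2, \ldots, x_{n-1} \in \mathbb{Z}^{\geq 0}$ with $x_i = x_j$ iff $i = j$. Then there exists $z \in \mathbb{Z}^{\geq 0}$ such that $(x_1, x_2, \ldots, x_{n-1}, z)$ is a $\mathcal{P}$-position for Antonim.
   Context: Antonim is a two-player game played on heaps of chips in which no two heaps may ever contain the same number of chips. A game-state is an ordered tuple $(x_1,\ldots,x_m)$ of non-negative integers with $x_i = x_j$ iff $i=j$ (the heap sizes). A move consists of removing a positive number of chips from a single heap, provided the resulting tuple is again a game-state (all entries pairwise distinct). Players alternate moves; a player who cannot move loses. A $\mathcal{P}$-position is a game-state from which the player whose turn it is loses, assuming the opponent plays perfectly; an $\mathcal{N}$-position is any game-state that is not a $\mathcal{P}$-position. In particular, a tuple being a $\mathcal{P}$-position includes that it is a valid game-state. -}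

module Defs where

open import Data.Nat using (ℕ; _<_)
open import Data.Fin using (Fin; fromℕ; inject₁)
open import Data.Product using (Σ; _×_)
open import Relation.Binary.PropositionalEquality using (_≡_; _≢_)

Tuple : ℕ → Set
Tuple m = Fin m → ℕ

IsState : ∀ {m} → Tuple m → Set
IsState x = ∀ i j → x i ≡ x j → i ≡ j

Move : ∀ {m} → Tuple m → Tuple m → Set
Move {m} x y = Σ (Fin m) λ i → (y i < x i) × (∀ j → j ≢ i → y j ≡ x j) × IsState y

-- P- and N-positions, defined inductively (the game is well-founded since the
-- total number of chips strictly decreases).
data IsP {m : ℕ} (x : Tuple m) : Set
data IsN {m : ℕ} (x : Tuple m) : Set

data IsP {m} x where
  isP : IsState x → (∀ y → Move x y → IsN y) → IsP x

data IsN {m} x where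
  isN : IsState x → ∀ y → Move x y → IsP y → IsN x

snoc : ∀ {m} → Tuple m → ℕ → Tuple (Data.Nat.suc m)
snoc {Data.Nat.zero} x z _ = z
snoc {Data.Nat.suc m} x z Fin.zero = x Fin.zero
snoc {Data.Nat.suc m} x z (Fin.suc i) = snoc (λ j → x (Fin.suc j)) z i

-- Fix the heaps x and look for the least z such that (x , z) is a
-- P-position.  By induction on the number of chips, every position x' that
-- x can move to already has such a least value z(x').  Take z to be the
-- least number that is neither a heap of x nor one of the z(x').  Moving the
-- last heap down to z' < z either collides with a heap of x or reaches some
-- z(x'), from which the opponent answers by moving x to x'.  Moving a heap of
-- x instead gives (x' , z) with z ≠ z(x'): if z > z(x') the opponent lowers
-- the last heap to z(x'), and if z < z(x') then (x' , z) is an N-position by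
-- the minimality of z(x').  The first case also shows that every state
-- (x , z') with z' < z is an N-position, which is the minimality needed for
-- the induction.

module Submission where

open import Defs
open import Data.Nat using (ℕ; zero; suc; _+_; _≤_; _<_; _∸_; _<?_; _≟_; s≤s⁻¹)
open import Data.Nat.Properties
  using (<-cmp; <-irrefl; 1+n≰n; n<1+n; m≤n⇒m<n∨m≡n; +-monoˡ-<; +-monoʳ-<)
open import Data.Nat.Induction using (<-wellFounded)
open import Data.Fin using (Fin; fromℕ; inject₁)
open import Data.Fin.Properties using (any?; fromℕ≢inject₁; inject₁-injective)
  renaming (_≟_ to _≟ᶠ_)
open import Data.Fin.Relation.Unary.Top using (view; ‵fromℕ; ‵inject₁)
open import Data.Vec.Functional using (updateAt; foldr; head; tail)
open import Data.Vec.Functional.Properties using (updateAt-updates; updateAt-minimal)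
open import Data.Product using (Σ; ∃; _×_; _,_; proj₂)
open import Data.Sum using (_⊎_; inj₁; inj₂)
open import Data.Empty using (⊥-elim)
open import Data.List using (List; []; [_]; _++_; tabulate; concatMap; upTo; allFin)
open import Data.List.Membership.Propositional using (_∈_; _∉_; lose)
open import Data.List.Membership.DecPropositional _≟_ using (_∈?_)
open import Data.List.Membership.Propositional.Properties
  using (∈-++⁺ˡ; ∈-++⁺ʳ; ∈-++⁻; ∈-tabulate⁺; ∈-tabulate⁻; ∈-concatMap⁺; ∈-concatMap⁻;
         ∈-allFin; ∈-upTo⁺)
open import Data.List.Relation.Unary.Any using (here; satisfied)
open import Data.List.Relation.Unary.All using (lookup)
open import Data.List.Extrema.Nat using (max; xs≤max)
open import Function using (const)
open import Induction.WellFounded using (Acc; acc)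
open import Relation.Binary using (tri<; tri≈; tri>)
open import Relation.Binary.PropositionalEquality
  using (_≡_; _≢_; _≗_; refl; sym; trans; cong; subst; subst₂)
open import Relation.Nullary using (¬_; Dec; yes; no; ¬?; _×-dec_; contradiction)

private
  variable
    m : ℕ

IsMex : List ℕ → ℕ → Set
IsMex L z = z ∉ L × (∀ w → w < z → w ∈ L)

mex-below : (L : List ℕ) (k : ℕ) → (∃ λ z → IsMex L z) ⊎ (∀ w → w < k → w ∈ L)
mex-below L zero = inj₂ (λ _ ())
mex-below L (suc k) with mex-below L k
... | inj₁ found = inj₁ found
... | inj₂ below with k ∈? L
...   | no k∉L = inj₁ (k , k∉L , below)
...   | yes k∈L = inj₂ λ w w<1+k → below-or-k (m≤n⇒m<n∨m≡n (s≤s⁻¹ w<1+k))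
  where
  below-or-k : ∀ {w} → w < k ⊎ w ≡ k → w ∈ L
  below-or-k (inj₁ w<k) = below _ w<k
  below-or-k (inj₂ refl) = k∈L

mex : (L : List ℕ) → ∃ λ z → IsMex L z
mex L with mex-below L (suc (suc (max 0 L)))
... | inj₁ found = found
... | inj₂ all∈L = ⊥-elim (1+n≰n (lookup (xs≤max 0 L) (all∈L _ (n<1+n _))))

InImage : Tuple m → ℕ → Set
InImage x v = ∃ λ j → x j ≡ v

inImage? : (x : Tuple m) (v : ℕ) → Dec (InImage x v)
inImage? x v = any? (λ j → x j ≟ v)

IsState-resp-≗ : {x y : Tuple m} → x ≗ y → IsState x → IsState y
IsState-resp-≗ x≗y x-state i j eq = x-state i j (trans (x≗y i) (trans eq (sym (x≗y j))))

Move-respˡ-≗ : {x x' y : Tuple m} → x ≗ x' → Move x y → Move x' y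
Move-respˡ-≗ {y = y} x≗x' (i , lt , others , y-state) =
  i , subst (y i <_) (x≗x' i) lt , (λ j j≢i → trans (others j j≢i) (x≗x' j)) , y-state

IsN-resp-≗ : {x x' : Tuple m} → x ≗ x' → IsN x → IsN x'
IsN-resp-≗ x≗x' (isN x-state y move y-P) =
  isN (IsState-resp-≗ x≗x' x-state) y (Move-respˡ-≗ x≗x' move) y-P

_[_]≔_ : Tuple m → Fin m → ℕ → Tuple m
x [ i ]≔ v = updateAt x i (const v)

IsState-update : {x : Tuple m} {v : ℕ} (i : Fin m) →
  IsState x → ¬ InImage x v → IsState (x [ i ]≔ v)
IsState-update {x = x} {v} i x-state v-free j k eq with j ≟ᶠ i | k ≟ᶠ i
... | yes refl | yes refl = refl
... | yes refl | no k≢i =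
  contradiction (k , trans (sym (updateAt-minimal k i x k≢i)) (trans (sym eq) (updateAt-updates i x))) v-free
... | no j≢i | yes refl =
  contradiction (j , trans (sym (updateAt-minimal j i x j≢i)) (trans eq (updateAt-updates i x))) v-free
... | no j≢i | no k≢i =
  x-state j k (trans (sym (updateAt-minimal j i x j≢i)) (trans eq (updateAt-minimal k i x k≢i)))

total : Tuple m → ℕ
total = foldr _+_ 0

total-update-< : (x : Tuple m) (i : Fin m) {v : ℕ} → v < x i → total (x [ i ]≔ v) < total x
total-update-< x Fin.zero v<xi = +-monoˡ-< (total (tail x)) v<xi
total-update-< x (Fin.suc i) v<xi = +-monoʳ-< (head x) (total-update-< (tail x) i v<xi)

snoc-fromℕ : (x : Tuple m) (z : ℕ) → snoc x z (fromℕ m) ≡ z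
snoc-fromℕ {zero} x z = refl
snoc-fromℕ {suc m} x z = snoc-fromℕ (tail x) z

snoc-inject₁ : (x : Tuple m) (z : ℕ) (j : Fin m) → snoc x z (inject₁ j) ≡ x j
snoc-inject₁ {suc m} x z Fin.zero = refl
snoc-inject₁ {suc m} x z (Fin.suc j) = snoc-inject₁ (tail x) z j

≗-snoc : {y : Tuple (suc m)} {x : Tuple m} {z : ℕ} →
  y (fromℕ m) ≡ z → (∀ j → y (inject₁ j) ≡ x j) → y ≗ snoc x z
≗-snoc {x = x} {z} last≡z init≡x k with view k
... | ‵fromℕ = trans last≡z (sym (snoc-fromℕ x z))
... | ‵inject₁ j = trans (init≡x j) (sym (snoc-inject₁ x z j))

IsState-snoc : {x : Tuple m} {z : ℕ} → IsState x → ¬ InImage x z → IsState (snoc x z)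
IsState-snoc {x = x} {z} x-state z-free i k eq with view i | view k
... | ‵fromℕ | ‵fromℕ = refl
... | ‵fromℕ | ‵inject₁ j =
  contradiction (j , trans (sym (snoc-inject₁ x z j)) (trans (sym eq) (snoc-fromℕ x z))) z-free
... | ‵inject₁ j | ‵fromℕ =
  contradiction (j , trans (sym (snoc-inject₁ x z j)) (trans eq (snoc-fromℕ x z))) z-free
... | ‵inject₁ j | ‵inject₁ j' =
  cong inject₁ (x-state j j' (trans (sym (snoc-inject₁ x z j)) (trans eq (snoc-inject₁ x z j'))))

IsState-snoc⁻ : {x : Tuple m} {z : ℕ} → IsState (snoc x z) → ¬ InImage x z
IsState-snoc⁻ {m} {x} {z} state (j , xj≡z) =
  fromℕ≢inject₁ (sym (state (inject₁ j) (fromℕ m)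
    (trans (snoc-inject₁ x z j) (trans xj≡z (sym (snoc-fromℕ x z))))))

Move-snoc-last : (x : Tuple m) {z z' : ℕ} → z' < z → IsState (snoc x z') →
  Move (snoc x z) (snoc x z')
Move-snoc-last {m} x {z} {z'} z'<z state =
  fromℕ m , subst₂ _<_ (sym (snoc-fromℕ x z')) (sym (snoc-fromℕ x z)) z'<z , others , state
  where
  others : ∀ k → k ≢ fromℕ m → snoc x z' k ≡ snoc x z k
  others k k≢last with view k
  ... | ‵fromℕ = contradiction refl k≢last
  ... | ‵inject₁ j = trans (snoc-inject₁ x z' j) (sym (snoc-inject₁ x z j))

Move-snoc-update : (x : Tuple m) (i : Fin m) {v z : ℕ} → v < x i →
  IsState (snoc (x [ i ]≔ v) z) → Move (snoc x z) (snoc (x [ i ]≔ v) z)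
Move-snoc-update {m} x i {v} {z} v<xi state =
  inject₁ i ,
  subst₂ _<_ (sym (trans (snoc-inject₁ (x [ i ]≔ v) z i) (updateAt-updates i x)))
             (sym (snoc-inject₁ x z i)) v<xi ,
  others , state
  where
  others : ∀ k → k ≢ inject₁ i → snoc (x [ i ]≔ v) z k ≡ snoc x z k
  others k k≢i with view k
  ... | ‵fromℕ = trans (snoc-fromℕ (x [ i ]≔ v) z) (sym (snoc-fromℕ x z))
  ... | ‵inject₁ j =
    trans (snoc-inject₁ (x [ i ]≔ v) z j)
      (trans (updateAt-minimal j i x (λ j≡i → k≢i (cong inject₁ j≡i))) (sym (snoc-inject₁ x z j)))

data SnocMove (x : Tuple m) (z : ℕ) (y : Tuple (suc m)) : Set where
  move-last : {z' : ℕ} → z' < z → y ≗ snoc x z' → SnocMove x z y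
  move-init : (i : Fin m) {v : ℕ} → v < x i → ¬ InImage x v →
              y ≗ snoc (x [ i ]≔ v) z → SnocMove x z y

snocMove : {x : Tuple m} {z : ℕ} {y : Tuple (suc m)} → Move (snoc x z) y → SnocMove x z y
snocMove {m} {x} {z} {y} (k , lt , others , y-state) with view k
... | ‵fromℕ =
  move-last (subst (y (fromℕ m) <_) (snoc-fromℕ x z) lt) (≗-snoc refl init-unchanged)
  where
  init-unchanged : ∀ j → y (inject₁ j) ≡ x j
  init-unchanged j = trans (others (inject₁ j) (λ eq → fromℕ≢inject₁ (sym eq))) (snoc-inject₁ x z j)
... | ‵inject₁ i =
  move-init i v<xi v-free
    (≗-snoc (trans (others (fromℕ m) fromℕ≢inject₁) (snoc-fromℕ x z)) init-updated)
  where
  v = y (inject₁ i)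
  v<xi : v < x i
  v<xi = subst (v <_) (snoc-inject₁ x z i) lt
  unchanged : ∀ j → j ≢ i → y (inject₁ j) ≡ x j
  unchanged j j≢i = trans (others (inject₁ j) (λ eq → j≢i (inject₁-injective eq))) (snoc-inject₁ x z j)
  v-free : ¬ InImage x v
  v-free (j , xj≡v) with j ≟ᶠ i
  ... | yes refl = <-irrefl (sym xj≡v) v<xi
  ... | no j≢i = j≢i (inject₁-injective (y-state (inject₁ j) (inject₁ i) (trans (unchanged j j≢i) xj≡v)))
  init-updated : ∀ j → y (inject₁ j) ≡ (x [ i ]≔ v) j
  init-updated j with j ≟ᶠ i
  ... | yes refl = sym (updateAt-updates i x)
  ... | no j≢i = trans (unchanged j j≢i) (sym (updateAt-minimal j i x j≢i))

record LeastPExtension (x : Tuple m) : Set where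
  field
    value : ℕ
    value-P : IsP (snoc x value)
    smaller-N : ∀ {z} → z < value → IsState (snoc x z) → IsN (snoc x z)

open LeastPExtension

LeastPValue : Tuple m → ℕ → Set
LeastPValue y w = Σ (LeastPExtension y) λ e → value e ≡ w

record Candidates (x : Tuple m) : Set where
  field
    list : List ℕ
    image⊆ : ∀ j → x j ∈ list
    extensions⊆ : (i : Fin m) {v : ℕ} → v < x i → ¬ InImage x v →
                  Σ (LeastPExtension (x [ i ]≔ v)) λ e → value e ∈ list
    ⊆image∪extensions : ∀ {w} → w ∈ list → InImage x w ⊎
      (∃ λ i → ∃ λ v → v < x i × LeastPValue (x [ i ]≔ v) w)

candidates : (x : Tuple m) →
  ((i : Fin m) {v : ℕ} → v < x i → ¬ InImage x v → LeastPExtension (x [ i ]≔ v)) →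
  Candidates x
candidates {m} x least = record
  { list = tabulate x ++ concatMap extensionsAt (allFin m)
  ; image⊆ = λ j → ∈-++⁺ˡ (∈-tabulate⁺ j)
  ; extensions⊆ = λ i v<xi v-free →
      let (e , e∈) = extensionAt-complete i v<xi v-free (legal? i _)
      in e , ∈-++⁺ʳ (tabulate x)
               (∈-concatMap⁺ extensionsAt (lose (∈-allFin i)
                 (∈-concatMap⁺ (λ v → extensionAt i v (legal? i v)) (lose (∈-upTo⁺ v<xi) e∈))))
  ; ⊆image∪extensions = sound
  }
  where
  Legal : Fin m → ℕ → Set
  Legal i v = v < x i × ¬ InImage x v

  legal? : ∀ i v → Dec (Legal i v)
  legal? i v = (v <? x i) ×-dec ¬? (inImage? x v)

  extensionAt : ∀ i v → Dec (Legal i v) → List ℕ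
  extensionAt i v (yes (v<xi , v-free)) = [ value (least i v<xi v-free) ]
  extensionAt i v (no _) = []

  extensionsAt : Fin m → List ℕ
  extensionsAt i = concatMap (λ v → extensionAt i v (legal? i v)) (upTo (x i))

  extensionAt-complete : ∀ i {v} → v < x i → ¬ InImage x v → (d : Dec (Legal i v)) →
    Σ (LeastPExtension (x [ i ]≔ v)) λ e → value e ∈ extensionAt i v d
  extensionAt-complete i _ _ (yes (v<xi , v-free)) = least i v<xi v-free , here refl
  extensionAt-complete i v<xi v-free (no illegal) = contradiction (v<xi , v-free) illegal

  extensionAt-sound : ∀ i v {w} (d : Dec (Legal i v)) → w ∈ extensionAt i v d →
    v < x i × LeastPValue (x [ i ]≔ v) w
  extensionAt-sound i v (yes (v<xi , v-free)) (here w≡) = v<xi , least i v<xi v-free , sym w≡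

  sound : ∀ {w} → w ∈ tabulate x ++ concatMap extensionsAt (allFin m) → InImage x w ⊎
    (∃ λ i → ∃ λ v → v < x i × LeastPValue (x [ i ]≔ v) w)
  sound w∈ with ∈-++⁻ (tabulate x) w∈
  ... | inj₁ w∈image = let (j , w≡xj) = ∈-tabulate⁻ w∈image in inj₁ (j , sym w≡xj)
  ... | inj₂ w∈extensions with satisfied (∈-concatMap⁻ extensionsAt {xs = allFin m} w∈extensions)
  ...   | i , w∈at with satisfied (∈-concatMap⁻ (λ v → extensionAt i v (legal? i v)) {xs = upTo (x i)} w∈at)
  ...     | v , w∈ext = inj₂ (i , v , extensionAt-sound i v (legal? i v) w∈ext)

mex-leastPExtension : {x : Tuple m} → IsState x → (C : Candidates x) →
  ∀ {z} → IsMex (Candidates.list C) z → LeastPExtension x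
mex-leastPExtension {m} {x} x-state C {z} (z∉list , below-z∈list) =
  record { value = z ; value-P = isP z-state moves-to-N ; smaller-N = below-z-N }
  where
  open Candidates C

  z-state : IsState (snoc x z)
  z-state = IsState-snoc x-state λ (j , xj≡z) → z∉list (subst (_∈ list) xj≡z (image⊆ j))

  below-z-N : ∀ {z'} → z' < z → IsState (snoc x z') → IsN (snoc x z')
  below-z-N z'<z state with ⊆image∪extensions (below-z∈list _ z'<z)
  ... | inj₁ z'-taken = contradiction z'-taken (IsState-snoc⁻ state)
  ... | inj₂ (i , v , v<xi , e , refl) with value-P e
  ...   | e-P@(isP e-state _) = isN state _ (Move-snoc-update x i v<xi e-state) e-P

  updated-N : ∀ i {v} → v < x i → ¬ InImage x v →
    IsState (snoc (x [ i ]≔ v) z) → IsN (snoc (x [ i ]≔ v) z)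
  updated-N i v<xi v-free state with extensions⊆ i v<xi v-free
  ... | e , e∈list with value-P e | <-cmp z (value e)
  ...   | _ | tri< z<e _ _ = smaller-N e z<e state
  ...   | _ | tri≈ _ z≡e _ = contradiction (subst (_∈ list) (sym z≡e) e∈list) z∉list
  ...   | e-P@(isP e-state _) | tri> _ _ e<z =
    isN state _ (Move-snoc-last (x [ i ]≔ _) e<z e-state) e-P

  moves-to-N : ∀ y → Move (snoc x z) y → IsN y
  moves-to-N y move@(_ , _ , _ , y-state) with snocMove move
  ... | move-last z'<z y≗ =
    IsN-resp-≗ (λ k → sym (y≗ k)) (below-z-N z'<z (IsState-resp-≗ y≗ y-state))
  ... | move-init i v<xi v-free y≗ =
    IsN-resp-≗ (λ k → sym (y≗ k)) (updated-N i v<xi v-free (IsState-resp-≗ y≗ y-state))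

leastPExtension : (x : Tuple m) → IsState x → LeastPExtension x
leastPExtension x x-state = go x x-state (<-wellFounded (total x))
  where
  go : (x : Tuple m) → IsState x → Acc _<_ (total x) → LeastPExtension x
  go x x-state (acc smaller) = mex-leastPExtension x-state C (proj₂ (mex (Candidates.list C)))
    where
    C : Candidates x
    C = candidates x λ i v<xi v-free →
      go (x [ i ]≔ _) (IsState-update i x-state v-free) (smaller (total-update-< x i v<xi))

theorem1 : (n : ℕ) → 2 ≤ n → (x : Tuple (n ∸ 1)) → IsState x →
    Σ ℕ λ z → IsP (snoc x z)
theorem1 _ _ x x-state = value e , value-P e
  where e = leastPExtension x x-state
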